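{- Let $k\ge 1$ and $n\ge 1$ be integers, and let $\lambda=(\lambda_1,\ldots,\lambda_n)$ be a partition of $kn(n-1)$ with at most $n$ nonzero parts (padded with zeros to length $n$) and $\lambda_1\le 2k(n-1)$. Define its box-complement $\lambda^{bc}=(2k(n-1)-\lambda_n,\,2k(n-1)-\lambda_{n-1},\,\ldots,\,2k(n-1)-\lambda_1)$, a partition of $kn(n-1)$. Then $$\langle a_{\delta_n}^{2k},s_{\lambda}\rangle=\langle a_{\delta_n}^{2k},s_{\lambda^{bc}}\rangle .$$
   Context: $a_{\delta_n}=\prod_{1\le i<j\le n}(x_i-x_j)$ is the Vandermonde determinant in $x_1,\ldots,x_n$; its even powers are symmetric polynomials. For a symmetric polynomial $f$ in $x_1,\ldots,x_n$ and a partition $\lambda$ with at most $n$ parts, $\langle f,s_\lambda\rangle$ denotes the coefficient of the Schur polynomial $s_\lambda(x_1,\ldots,x_n)$ in the expansion of $f$ in the Schur basis; equivalently $\langle a_{\delta_n}^{2k},s_\lambda\rangle$ is the coefficient of $x^{\lambda+\delta_n}=\prod_i x_i^{\lambda_i+n-i}$ in $a_{\delta_n}^{2k+1}$, where $\delta_n=(n-1,n-2,\ldots,1,0)$. -}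

module Defs where

open import Data.Nat as ℕ using (ℕ; zero; suc; _∸_; _≤_)
open import Data.Integer as ℤ using (ℤ; +_; -[1+_])
open import Data.Fin using (Fin; toℕ; opposite; _<_)
open import Data.Vec using (Vec; lookup; tabulate; zipWith; replicate)
open import Data.Vec.Properties using (≡-dec)
open import Data.List using (List; []; _∷_; concatMap; map; _++_; allFin; sum)
open import Data.Product using (_×_; _,_)
open import Relation.Nullary using (yes; no)

-- A polynomial in n variables over ℤ: a finite formal sum of terms
-- (coefficient , exponent vector). Not necessarily normalised.
Poly : ℕ → Set
Poly n = List (ℤ × Vec ℕ n)

one : ∀ {n} → Poly n
one = (ℤ.+ 1 , replicate _ 0) ∷ []

var : ∀ {n} → Fin n → Poly n
var {n} i = (ℤ.+ 1 , tabulate (λ j → δij i j)) ∷ []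
  where
  δij : Fin n → Fin n → ℕ
  δij i j with Data.Fin._≟_ i j
  ... | yes _ = 1
  ... | no _ = 0

neg : ∀ {n} → Poly n → Poly n
neg = map (λ { (c , e) → (ℤ.- c , e) })

_⊕_ : ∀ {n} → Poly n → Poly n → Poly n
p ⊕ q = p ++ q

_⊗_ : ∀ {n} → Poly n → Poly n → Poly n
p ⊗ q = concatMap (λ { (c , e) → map (λ { (d , f) → (c ℤ.* d , zipWith ℕ._+_ e f) }) q }) p

_^_ : ∀ {n} → Poly n → ℕ → Poly n
p ^ zero = one
p ^ suc m = p ⊗ (p ^ m)

prodList : ∀ {n} → List (Poly n) → Poly n
prodList [] = one
prodList (p ∷ ps) = p ⊗ prodList ps

pairs : ∀ n → List (Fin n × Fin n)
pairs n = concatMap (λ i → concatMap (λ j → ifLt i j) (allFin n)) (allFin n)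
  where
  ifLt : Fin n → Fin n → List (Fin n × Fin n)
  ifLt i j with Data.Fin._<?_ i j
  ... | yes _ = (i , j) ∷ []
  ... | no _ = []

vandermonde : ∀ n → Poly n
vandermonde n = prodList (map (λ { (i , j) → var i ⊕ neg (var j) }) (pairs n))

coeff : ∀ {n} → Poly n → Vec ℕ n → ℤ
coeff [] e = + 0
coeff ((c , f) ∷ ts) e with ≡-dec ℕ._≟_ f e
... | yes _ = c ℤ.+ coeff ts e
... | no _ = coeff ts e

delta : ∀ n → Vec ℕ n
delta n = tabulate (λ i → n ∸ suc (toℕ i))

-- ⟨ a_δ^{2k} , s_λ ⟩ := coefficient of x^{λ+δ} in a_δ^{2k+1}
-- (bialternant formula s_λ = a_{λ+δ}/a_δ, as in the paper's context)
vdmSchurCoeff : ∀ n → ℕ → Vec ℕ n → ℤ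
vdmSchurCoeff n k lam =
  coeff (vandermonde n ^ suc (2 ℕ.* k)) (zipWith ℕ._+_ lam (delta n))

Decreasing : ∀ {n} → Vec ℕ n → Set
Decreasing {n} lam = ∀ (i j : Fin n) → i Data.Fin.≤ j → lookup lam j ≤ lookup lam i

boxComplement : ∀ {n} → ℕ → Vec ℕ n → Vec ℕ n
boxComplement b lam = tabulate (λ i → b ∸ lookup lam (opposite i))

-- With s = 2k + 1, ⟨a_δ^{2k}, s_λ⟩ is the coefficient of x^(λ+δ) in V^s,
-- where V = ∏_{i<j} (x_i - x_j).  Every variable occurs in exactly n - 1 of
-- the factors, so every monomial of V divides x^D with D = (n-1, …, n-1).
-- Reflecting monomials in their box, x^e ↦ x^(rev (D - e)), sends the factor
-- x_i - x_j (in its box x_i x_j) to the factor x_{j'} - x_{i'}, where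
-- i' = n-1-i; hence it merely permutes the factors of V and V is fixed.
-- Reflection is multiplicative on bounded polynomials, so it also fixes V^s
-- in the box s·D, and being injective it preserves coefficients:
-- [x^e] V^s = [x^(e^bc)] V^s for every e in the box.  For e = λ + δ the box
-- complement is λ^bc + δ, which is the theorem.
module Submission where

open import Defs
open import Data.Nat using (ℕ; suc; _*_; _≤_)
open import Data.Fin using (zero)
open import Data.Vec using (Vec; lookup; sum)
open import Relation.Binary.PropositionalEquality using (_≡_)

open import Data.Empty using (⊥-elim)
open import Data.Fin using (Fin; suc; opposite; toℕ)
import Data.Fin as Fin
import Data.Fin.Properties as FinP
open import Data.Integer using (ℤ; 0ℤ; 1ℤ; -1ℤ) renaming (_+_ to _+ℤ_; _*_ to _*ℤ_)
import Data.Integer.Properties as ℤP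
open import Algebra.Properties.CommutativeSemigroup ℤP.+-commutativeSemigroup using (interchange)
open import Data.List using (List; []; _∷_; _++_; map; concatMap; filter; cartesianProduct; allFin)
import Data.List as List
import Data.List.Properties as ListP
open import Data.List.Membership.Propositional using (_∈_)
open import Data.List.Membership.Propositional.Properties
  using (∈-filter⁺; ∈-filter⁻; ∈-cartesianProduct⁺; ∈-allFin; ∈-map⁺; ∈-map⁻)
open import Data.List.Membership.Propositional.Properties.WithK using (unique∧set⇒bag)
open import Data.List.Relation.Binary.BagAndSetEquality using (∼bag⇒↭)
open import Data.List.Relation.Binary.Permutation.Propositional using (_↭_; prep; swap)
import Data.List.Relation.Binary.Permutation.Propositional as Perm
import Data.List.Relation.Binary.Permutation.Propositional.Properties as PermP
open import Data.List.Relation.Unary.All using (All; []; _∷_)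
import Data.List.Relation.Unary.All as All
import Data.List.Relation.Unary.All.Properties as AllP
open import Data.List.Relation.Unary.Unique.Propositional using (Unique)
import Data.List.Relation.Unary.Unique.Propositional.Properties as UniqueP
open import Data.Nat using (_+_; _∸_; z≤n)
import Data.Nat as ℕ
import Data.Nat.Properties as ℕP
import Algebra.Properties.Semiring.Sum ℕP.+-*-semiring as ∑
open ∑ using (sum-syntax)
open import Data.Product using (Σ; _×_; _,_; proj₁; proj₂; map₂)
open import Data.Vec using (tabulate; zipWith; replicate)
open import Data.Vec.Properties using (≡-dec; lookup-zipWith; lookup∘tabulate; tabulate-cong; lookup-replicate)
open import Data.Vec.Relation.Binary.Pointwise.Extensional using (Pointwise; ext; extensional⇒inductive)
import Data.Vec.Relation.Binary.Pointwise.Extensional as Pointwise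
open import Data.Vec.Relation.Binary.Pointwise.Inductive using (Pointwise-≡⇒≡)
open import Function.Bundles using (mk⇔)
open import Relation.Nullary using (Dec; yes; no; ¬_)
open import Relation.Binary.PropositionalEquality
  using (_≢_; refl; sym; trans; cong; cong₂; subst; subst₂; module ≡-Reasoning)

sumOver : {A : Set} → List A → (A → ℤ) → ℤ
sumOver []       g = 0ℤ
sumOver (x ∷ xs) g = g x +ℤ sumOver xs g

sumOver-cong : ∀ {A : Set} (xs : List A) {g h : A → ℤ} →
  (∀ x → g x ≡ h x) → sumOver xs g ≡ sumOver xs h
sumOver-cong []       g≗h = refl
sumOver-cong (x ∷ xs) g≗h = cong₂ _+ℤ_ (g≗h x) (sumOver-cong xs g≗h)

sumOver-zero : ∀ {A : Set} (xs : List A) → sumOver xs (λ _ → 0ℤ) ≡ 0ℤ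
sumOver-zero []       = refl
sumOver-zero (x ∷ xs) = trans (ℤP.+-identityˡ _) (sumOver-zero xs)

sumOver-++ : ∀ {A : Set} (xs ys : List A) g →
  sumOver (xs ++ ys) g ≡ sumOver xs g +ℤ sumOver ys g
sumOver-++ []       ys g = sym (ℤP.+-identityˡ _)
sumOver-++ (x ∷ xs) ys g =
  trans (cong (g x +ℤ_) (sumOver-++ xs ys g)) (sym (ℤP.+-assoc (g x) _ _))

sumOver-map : ∀ {A B : Set} (f : A → B) (xs : List A) g →
  sumOver (map f xs) g ≡ sumOver xs (λ x → g (f x))
sumOver-map f []       g = refl
sumOver-map f (x ∷ xs) g = cong (g (f x) +ℤ_) (sumOver-map f xs g)

sumOver-concatMap : ∀ {A B : Set} (f : A → List B) (xs : List A) g →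
  sumOver (concatMap f xs) g ≡ sumOver xs (λ x → sumOver (f x) g)
sumOver-concatMap f []       g = refl
sumOver-concatMap f (x ∷ xs) g =
  trans (sumOver-++ (f x) (concatMap f xs) g) (cong (sumOver (f x) g +ℤ_) (sumOver-concatMap f xs g))

sumOver-+ : ∀ {A : Set} (xs : List A) (g h : A → ℤ) →
  sumOver xs (λ x → g x +ℤ h x) ≡ sumOver xs g +ℤ sumOver xs h
sumOver-+ []       g h = refl
sumOver-+ (x ∷ xs) g h =
  trans (cong (g x +ℤ h x +ℤ_) (sumOver-+ xs g h)) (interchange (g x) (h x) (sumOver xs g) (sumOver xs h))

sumOver-swap : ∀ {A B : Set} (xs : List A) (ys : List B) (h : A → B → ℤ) →
  sumOver xs (λ x → sumOver ys (h x)) ≡ sumOver ys (λ y → sumOver xs (λ x → h x y))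
sumOver-swap []       ys h = sym (sumOver-zero ys)
sumOver-swap (x ∷ xs) ys h =
  trans (cong (sumOver ys (h x) +ℤ_) (sumOver-swap xs ys h)) (sym (sumOver-+ ys (h x) _))

sumOver-*ˡ : ∀ {A : Set} (xs : List A) c (g : A → ℤ) →
  c *ℤ sumOver xs g ≡ sumOver xs (λ x → c *ℤ g x)
sumOver-*ˡ []       c g = ℤP.*-zeroʳ c
sumOver-*ˡ (x ∷ xs) c g = trans (ℤP.*-distribˡ-+ c (g x) _) (cong (c *ℤ g x +ℤ_) (sumOver-*ˡ xs c g))

infixl 6 _+ᵥ_ _∸ᵥ_
infix 4 _≤ᵥ_

_+ᵥ_ : ∀ {n} → Vec ℕ n → Vec ℕ n → Vec ℕ n
_+ᵥ_ = zipWith _+_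

_∸ᵥ_ : ∀ {n} → Vec ℕ n → Vec ℕ n → Vec ℕ n
_∸ᵥ_ = zipWith _∸_

-- Componentwise order: f ≤ᵥ e says that x^f divides x^e.
_≤ᵥ_ : ∀ {n} → Vec ℕ n → Vec ℕ n → Set
_≤ᵥ_ = Pointwise _≤_

_≤ᵥ?_ : ∀ {n} (f e : Vec ℕ n) → Dec (f ≤ᵥ e)
_≤ᵥ?_ = Pointwise.decidable ℕP._≤?_

vecExt : ∀ {n} {u v : Vec ℕ n} → (∀ a → lookup u a ≡ lookup v a) → u ≡ v
vecExt u≗v = Pointwise-≡⇒≡ (extensional⇒inductive (ext u≗v))

lookup-+ᵥ : ∀ {n} (f g : Vec ℕ n) a → lookup (f +ᵥ g) a ≡ lookup f a + lookup g a
lookup-+ᵥ f g a = lookup-zipWith _+_ a f g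

lookup-∸ᵥ : ∀ {n} (f g : Vec ℕ n) a → lookup (f ∸ᵥ g) a ≡ lookup f a ∸ lookup g a
lookup-∸ᵥ f g a = lookup-zipWith _∸_ a f g

+ᵥ-comm : ∀ {n} (f g : Vec ℕ n) → f +ᵥ g ≡ g +ᵥ f
+ᵥ-comm f g = vecExt λ a → begin
  lookup (f +ᵥ g) a       ≡⟨ lookup-+ᵥ f g a ⟩
  lookup f a + lookup g a ≡⟨ ℕP.+-comm (lookup f a) _ ⟩
  lookup g a + lookup f a ≡⟨ lookup-+ᵥ g f a ⟨
  lookup (g +ᵥ f) a       ∎
  where open ≡-Reasoning

+ᵥ-assoc : ∀ {n} (f g h : Vec ℕ n) → f +ᵥ g +ᵥ h ≡ f +ᵥ (g +ᵥ h)
+ᵥ-assoc f g h = vecExt λ a → begin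
  lookup (f +ᵥ g +ᵥ h) a                 ≡⟨ lookup-+ᵥ (f +ᵥ g) h a ⟩
  lookup (f +ᵥ g) a + lookup h a         ≡⟨ cong (_+ lookup h a) (lookup-+ᵥ f g a) ⟩
  lookup f a + lookup g a + lookup h a   ≡⟨ ℕP.+-assoc (lookup f a) _ _ ⟩
  lookup f a + (lookup g a + lookup h a) ≡⟨ cong (lookup f a +_) (lookup-+ᵥ g h a) ⟨
  lookup f a + lookup (g +ᵥ h) a         ≡⟨ lookup-+ᵥ f (g +ᵥ h) a ⟨
  lookup (f +ᵥ (g +ᵥ h)) a               ∎
  where open ≡-Reasoning

+ᵥ-∸ᵥ : ∀ {n} (f g : Vec ℕ n) → (f +ᵥ g) ∸ᵥ f ≡ g
+ᵥ-∸ᵥ f g = vecExt λ a →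
  trans (lookup-∸ᵥ (f +ᵥ g) f a)
        (trans (cong (_∸ lookup f a) (lookup-+ᵥ f g a)) (ℕP.m+n∸m≡n (lookup f a) (lookup g a)))

∸ᵥ-+ᵥ : ∀ {n} {f e : Vec ℕ n} → f ≤ᵥ e → f +ᵥ (e ∸ᵥ f) ≡ e
∸ᵥ-+ᵥ {f = f} {e} f≤e = vecExt λ a →
  trans (lookup-+ᵥ f (e ∸ᵥ f) a)
        (trans (cong (lookup f a +_) (lookup-∸ᵥ e f a)) (ℕP.m+[n∸m]≡n (Pointwise.app f≤e a)))

≤ᵥ-+ᵥ : ∀ {n} (f g : Vec ℕ n) → f ≤ᵥ f +ᵥ g
≤ᵥ-+ᵥ f g = ext λ a → subst (lookup f a ≤_) (sym (lookup-+ᵥ f g a)) (ℕP.m≤m+n _ _)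

+ᵥ-mono-≤ᵥ : ∀ {n} {f g d₁ d₂ : Vec ℕ n} → f ≤ᵥ d₁ → g ≤ᵥ d₂ → f +ᵥ g ≤ᵥ d₁ +ᵥ d₂
+ᵥ-mono-≤ᵥ {f = f} {g} {d₁} {d₂} f≤d₁ g≤d₂ = ext λ a →
  subst₂ _≤_ (sym (lookup-+ᵥ f g a)) (sym (lookup-+ᵥ d₁ d₂ a))
    (ℕP.+-mono-≤ (Pointwise.app f≤d₁ a) (Pointwise.app g≤d₂ a))

Term : ℕ → Set
Term n = ℤ × Vec ℕ n

termCoeff : ∀ {n} → Vec ℕ n → Term n → ℤ
termCoeff e (c , f) with ≡-dec ℕ._≟_ f e
... | yes _ = c
... | no  _ = 0ℤ

coeff-sumOver : ∀ {n} (p : Poly n) e → coeff p e ≡ sumOver p (termCoeff e)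
coeff-sumOver []             e = refl
coeff-sumOver ((c , f) ∷ p) e with ≡-dec ℕ._≟_ f e
... | yes _ = cong (c +ℤ_) (coeff-sumOver p e)
... | no  _ = trans (coeff-sumOver p e) (sym (ℤP.+-identityˡ _))

infixl 7 _·_

_·_ : ∀ {n} → Term n → Term n → Term n
(c , f) · (d , g) = (c *ℤ d , f +ᵥ g)

·-comm : ∀ {n} (t u : Term n) → t · u ≡ u · t
·-comm (c , f) (d , g) = cong₂ _,_ (ℤP.*-comm c d) (+ᵥ-comm f g)

·-leftComm : ∀ {n} (t u v : Term n) → t · (u · v) ≡ u · (t · v)
·-leftComm (c , f) (d , g) (d′ , h) = cong₂ _,_
  (trans (sym (ℤP.*-assoc c d d′)) (trans (cong (_*ℤ d′) (ℤP.*-comm c d)) (ℤP.*-assoc d c d′)))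
  (trans (sym (+ᵥ-assoc f g h)) (trans (cong (_+ᵥ h) (+ᵥ-comm f g)) (+ᵥ-assoc g f h)))

sumOver-⊗ : ∀ {n} (p q : Poly n) (G : Term n → ℤ) →
  sumOver (p ⊗ q) G ≡ sumOver p (λ t → sumOver q (λ u → G (t · u)))
sumOver-⊗ p q G = trans (sumOver-concatMap _ p G) (sumOver-cong p (λ t → sumOver-map _ q G))

coeff-⊗ : ∀ {n} (p q : Poly n) e →
  coeff (p ⊗ q) e ≡ sumOver p (λ t → sumOver q (λ u → termCoeff e (t · u)))
coeff-⊗ p q e = trans (coeff-sumOver (p ⊗ q) e) (sumOver-⊗ p q (termCoeff e))

termCoeff-·-divides : ∀ {n} c {f e : Vec ℕ n} → f ≤ᵥ e → (u : Term n) →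
  termCoeff e ((c , f) · u) ≡ c *ℤ termCoeff (e ∸ᵥ f) u
termCoeff-·-divides c {f} {e} f≤e (d , g)
  with ≡-dec ℕ._≟_ (f +ᵥ g) e | ≡-dec ℕ._≟_ g (e ∸ᵥ f)
... | yes _     | yes _    = refl
... | yes f+g≡e | no  g≢e-f = ⊥-elim (g≢e-f (trans (sym (+ᵥ-∸ᵥ f g)) (cong (_∸ᵥ f) f+g≡e)))
... | no  f+g≢e | yes refl = ⊥-elim (f+g≢e (∸ᵥ-+ᵥ f≤e))
... | no  _     | no  _    = sym (ℤP.*-zeroʳ c)

termCoeff-·-nonDivides : ∀ {n} c {f e : Vec ℕ n} → ¬ f ≤ᵥ e → (u : Term n) →
  termCoeff e ((c , f) · u) ≡ 0ℤ
termCoeff-·-nonDivides c {f} {e} f≰e (d , g) with ≡-dec ℕ._≟_ (f +ᵥ g) e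
... | yes refl = ⊥-elim (f≰e (≤ᵥ-+ᵥ f g))
... | no  _    = refl

infix 4 _≈_

_≈_ : ∀ {n} → Poly n → Poly n → Set
p ≈ q = ∀ e → coeff p e ≡ coeff q e

⊗-comm : ∀ {n} (p q : Poly n) → p ⊗ q ≈ q ⊗ p
⊗-comm p q e = begin
  coeff (p ⊗ q) e                                          ≡⟨ coeff-⊗ p q e ⟩
  sumOver p (λ t → sumOver q (λ u → termCoeff e (t · u)))  ≡⟨ sumOver-swap p q _ ⟩
  sumOver q (λ u → sumOver p (λ t → termCoeff e (t · u)))  ≡⟨ sumOver-cong q (λ u → sumOver-cong p (λ t → cong (termCoeff e) (·-comm t u))) ⟩
  sumOver q (λ u → sumOver p (λ t → termCoeff e (u · t)))  ≡⟨ coeff-⊗ q p e ⟨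
  coeff (q ⊗ p) e                                          ∎
  where open ≡-Reasoning

⊗-leftComm : ∀ {n} (p q r : Poly n) → p ⊗ (q ⊗ r) ≈ q ⊗ (p ⊗ r)
⊗-leftComm p q r e = begin
  coeff (p ⊗ (q ⊗ r)) e
    ≡⟨ coeff-⊗ p (q ⊗ r) e ⟩
  sumOver p (λ t → sumOver (q ⊗ r) (λ u → termCoeff e (t · u)))
    ≡⟨ sumOver-cong p (λ t → sumOver-⊗ q r _) ⟩
  sumOver p (λ t → sumOver q (λ v → sumOver r (λ w → termCoeff e (t · (v · w)))))
    ≡⟨ sumOver-swap p q _ ⟩
  sumOver q (λ v → sumOver p (λ t → sumOver r (λ w → termCoeff e (t · (v · w)))))
    ≡⟨ sumOver-cong q (λ v → sumOver-cong p (λ t → sumOver-cong r (λ w → cong (termCoeff e) (·-leftComm t v w)))) ⟩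
  sumOver q (λ v → sumOver p (λ t → sumOver r (λ w → termCoeff e (v · (t · w)))))
    ≡⟨ sumOver-cong q (λ v → sumOver-⊗ p r _) ⟨
  sumOver q (λ v → sumOver (p ⊗ r) (λ u → termCoeff e (v · u)))
    ≡⟨ coeff-⊗ q (p ⊗ r) e ⟨
  coeff (q ⊗ (p ⊗ r)) e
    ∎
  where open ≡-Reasoning

-- Multiplication respects equivalence: the contribution of each term c·x^f
-- of p depends on q only through the coefficient of x^(e-f) in q.
⊗-congʳ : ∀ {n} (p : Poly n) {q q′ : Poly n} → q ≈ q′ → p ⊗ q ≈ p ⊗ q′
⊗-congʳ {n} p {q} {q′} q≈q′ e =
  trans (coeff-⊗ p q e) (trans (sumOver-cong p termwise) (sym (coeff-⊗ p q′ e)))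
  where
  open ≡-Reasoning
  contribution : ∀ c f (r : Poly n) → f ≤ᵥ e →
    sumOver r (λ u → termCoeff e ((c , f) · u)) ≡ c *ℤ coeff r (e ∸ᵥ f)
  contribution c f r f≤e = begin
    sumOver r (λ u → termCoeff e ((c , f) · u))  ≡⟨ sumOver-cong r (termCoeff-·-divides c f≤e) ⟩
    sumOver r (λ u → c *ℤ termCoeff (e ∸ᵥ f) u)  ≡⟨ sumOver-*ˡ r c _ ⟨
    c *ℤ sumOver r (termCoeff (e ∸ᵥ f))          ≡⟨ cong (c *ℤ_) (coeff-sumOver r _) ⟨
    c *ℤ coeff r (e ∸ᵥ f)                        ∎
  termwise : ∀ t → sumOver q (λ u → termCoeff e (t · u)) ≡ sumOver q′ (λ u → termCoeff e (t · u))
  termwise (c , f) with f ≤ᵥ? e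
  ... | yes f≤e = begin
    sumOver q (λ u → termCoeff e ((c , f) · u))   ≡⟨ contribution c f q f≤e ⟩
    c *ℤ coeff q (e ∸ᵥ f)                         ≡⟨ cong (c *ℤ_) (q≈q′ (e ∸ᵥ f)) ⟩
    c *ℤ coeff q′ (e ∸ᵥ f)                        ≡⟨ contribution c f q′ f≤e ⟨
    sumOver q′ (λ u → termCoeff e ((c , f) · u))  ∎
  ... | no f≰e = begin
    sumOver q (λ u → termCoeff e ((c , f) · u))   ≡⟨ sumOver-cong q (termCoeff-·-nonDivides c f≰e) ⟩
    sumOver q (λ _ → 0ℤ)                          ≡⟨ sumOver-zero q ⟩
    0ℤ                                            ≡⟨ sumOver-zero q′ ⟨
    sumOver q′ (λ _ → 0ℤ)                         ≡⟨ sumOver-cong q′ (termCoeff-·-nonDivides c f≰e) ⟨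
    sumOver q′ (λ u → termCoeff e ((c , f) · u))  ∎

⊗-congˡ : ∀ {n} {p p′ : Poly n} (q : Poly n) → p ≈ p′ → p ⊗ q ≈ p′ ⊗ q
⊗-congˡ {p = p} {p′} q p≈p′ e =
  trans (⊗-comm p q e) (trans (⊗-congʳ q p≈p′ e) (⊗-comm q p′ e))

prodList-↭ : ∀ {n} {ps qs : List (Poly n)} → ps ↭ qs → prodList ps ≈ prodList qs
prodList-↭ Perm.refl           e = refl
prodList-↭ (prep p ps↭qs)      e = ⊗-congʳ p (prodList-↭ ps↭qs) e
prodList-↭ (swap p q ps↭qs)    e =
  trans (⊗-congʳ p (⊗-congʳ q (prodList-↭ ps↭qs)) e) (⊗-leftComm p q _ e)
prodList-↭ (Perm.trans ps↭rs rs↭qs) e = trans (prodList-↭ ps↭rs e) (prodList-↭ rs↭qs e)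

^-cong : ∀ {n} {p q : Poly n} s → p ≈ q → p ^ s ≈ q ^ s
^-cong ℕ.zero    p≈q e = refl
^-cong {p = p} {q} (suc s) p≈q e =
  trans (⊗-congˡ {p = p} {q} (p ^ s) p≈q e) (⊗-congʳ q {p ^ s} {q ^ s} (^-cong s p≈q) e)

-- Reflecting monomials inside a box

reflect : ∀ {n} → Vec ℕ n → Vec ℕ n → Vec ℕ n
reflect d f = tabulate (λ a → lookup d (opposite a) ∸ lookup f (opposite a))

lookup-reflect : ∀ {n} (d f : Vec ℕ n) a →
  lookup (reflect d f) a ≡ lookup d (opposite a) ∸ lookup f (opposite a)
lookup-reflect d f a = lookup∘tabulate _ a

+-∸-interchange : ∀ {x y u v} → u ≤ x → v ≤ y → (x + y) ∸ (u + v) ≡ (x ∸ u) + (y ∸ v)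
+-∸-interchange {x} {y} {u} {v} u≤x v≤y = begin
  (x + y) ∸ (u + v)  ≡⟨ ℕP.∸-+-assoc (x + y) u v ⟨
  (x + y) ∸ u ∸ v    ≡⟨ cong (_∸ v) (ℕP.+-∸-comm y u≤x) ⟩
  (x ∸ u + y) ∸ v    ≡⟨ ℕP.+-∸-assoc (x ∸ u) v≤y ⟩
  (x ∸ u) + (y ∸ v)  ∎
  where open ≡-Reasoning

reflect-+ᵥ : ∀ {n} {d₁ d₂ f g : Vec ℕ n} → f ≤ᵥ d₁ → g ≤ᵥ d₂ →
  reflect (d₁ +ᵥ d₂) (f +ᵥ g) ≡ reflect d₁ f +ᵥ reflect d₂ g
reflect-+ᵥ {d₁ = d₁} {d₂} {f} {g} f≤d₁ g≤d₂ = vecExt λ a →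
  let b = opposite a in begin
  lookup (reflect (d₁ +ᵥ d₂) (f +ᵥ g)) a
    ≡⟨ lookup-reflect (d₁ +ᵥ d₂) (f +ᵥ g) a ⟩
  lookup (d₁ +ᵥ d₂) b ∸ lookup (f +ᵥ g) b
    ≡⟨ cong₂ _∸_ (lookup-+ᵥ d₁ d₂ b) (lookup-+ᵥ f g b) ⟩
  (lookup d₁ b + lookup d₂ b) ∸ (lookup f b + lookup g b)
    ≡⟨ +-∸-interchange (Pointwise.app f≤d₁ b) (Pointwise.app g≤d₂ b) ⟩
  (lookup d₁ b ∸ lookup f b) + (lookup d₂ b ∸ lookup g b)
    ≡⟨ cong₂ _+_ (lookup-reflect d₁ f a) (lookup-reflect d₂ g a) ⟨
  lookup (reflect d₁ f) a + lookup (reflect d₂ g) a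
    ≡⟨ lookup-+ᵥ (reflect d₁ f) (reflect d₂ g) a ⟨
  lookup (reflect d₁ f +ᵥ reflect d₂ g) a
    ∎
  where open ≡-Reasoning

reflect-injective : ∀ {n} {d f e : Vec ℕ n} → f ≤ᵥ d → e ≤ᵥ d → reflect d f ≡ reflect d e → f ≡ e
reflect-injective {d = d} {f} {e} f≤d e≤d same = vecExt λ a → begin
  lookup f a                            ≡⟨ ℕP.m∸[m∸n]≡n (Pointwise.app f≤d a) ⟨
  lookup d a ∸ (lookup d a ∸ lookup f a) ≡⟨ cong (lookup d a ∸_) (differences a) ⟩
  lookup d a ∸ (lookup d a ∸ lookup e a) ≡⟨ ℕP.m∸[m∸n]≡n (Pointwise.app e≤d a) ⟩
  lookup e a                            ∎
  where
  open ≡-Reasoning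
  differences : ∀ a → lookup d a ∸ lookup f a ≡ lookup d a ∸ lookup e a
  differences a = subst (λ b → lookup d b ∸ lookup f b ≡ lookup d b ∸ lookup e b)
    (FinP.opposite-involutive a)
    (trans (sym (lookup-reflect d f (opposite a)))
      (trans (cong (λ v → lookup v (opposite a)) same) (lookup-reflect d e (opposite a))))

reflectPoly : ∀ {n} → Vec ℕ n → Poly n → Poly n
reflectPoly d = map (map₂ (reflect d))

Bounded : ∀ {n} → Vec ℕ n → Poly n → Set
Bounded d = All (λ t → proj₂ t ≤ᵥ d)

Bounded-⊗ : ∀ {n} {d₁ d₂ : Vec ℕ n} {p q : Poly n} →
  Bounded d₁ p → Bounded d₂ q → Bounded (d₁ +ᵥ d₂) (p ⊗ q)
Bounded-⊗ []           q≤d₂ = []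
Bounded-⊗ (t≤d₁ ∷ p≤d₁) q≤d₂ =
  AllP.++⁺ (AllP.map⁺ (All.map (+ᵥ-mono-≤ᵥ t≤d₁) q≤d₂)) (Bounded-⊗ p≤d₁ q≤d₂)

reflectPoly-⊗ : ∀ {n} {d₁ d₂ : Vec ℕ n} (p q : Poly n) → Bounded d₁ p → Bounded d₂ q →
  reflectPoly (d₁ +ᵥ d₂) (p ⊗ q) ≡ reflectPoly d₁ p ⊗ reflectPoly d₂ q
reflectPoly-⊗ []      q []           q≤d₂ = refl
reflectPoly-⊗ {d₁ = d₁} {d₂} (t ∷ p) q (t≤d₁ ∷ p≤d₁) q≤d₂ =
  trans (ListP.map-++ _ (map (t ·_) q) (p ⊗ q))
        (cong₂ _++_ row (reflectPoly-⊗ p q p≤d₁ q≤d₂))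
  where
  row : reflectPoly (d₁ +ᵥ d₂) (map (t ·_) q) ≡ map (map₂ (reflect d₁) t ·_) (reflectPoly d₂ q)
  row = trans (sym (ListP.map-∘ q))
    (trans (ListP.map-cong-local (All.map (λ u≤d₂ → cong (proj₁ t *ℤ _ ,_) (reflect-+ᵥ t≤d₁ u≤d₂)) q≤d₂))
      (ListP.map-∘ q))

0ᵥ : ∀ {n} → Vec ℕ n
0ᵥ = replicate _ 0

_×ᵥ_ : ∀ {n} → ℕ → Vec ℕ n → Vec ℕ n
ℕ.zero  ×ᵥ d = 0ᵥ
(suc s) ×ᵥ d = d +ᵥ (s ×ᵥ d)

lookup-×ᵥ : ∀ {n} s (d : Vec ℕ n) a → lookup (s ×ᵥ d) a ≡ s * lookup d a
lookup-×ᵥ ℕ.zero  d a = lookup-replicate a 0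
lookup-×ᵥ (suc s) d a = trans (lookup-+ᵥ d (s ×ᵥ d) a) (cong (lookup d a +_) (lookup-×ᵥ s d a))

Bounded-one : ∀ {n} → Bounded (0ᵥ {n}) one
Bounded-one = ext (λ _ → ℕP.≤-refl) ∷ []

reflectPoly-one : ∀ {n} → reflectPoly (0ᵥ {n}) one ≡ one
reflectPoly-one = cong (λ v → (1ℤ , v) ∷ []) (vecExt λ a →
  trans (lookup-reflect 0ᵥ 0ᵥ a)
    (trans (cong₂ _∸_ (lookup-replicate (opposite a) 0) (lookup-replicate (opposite a) 0))
      (sym (lookup-replicate a 0))))

Bounded-^ : ∀ {n} {d : Vec ℕ n} {p : Poly n} → Bounded d p → ∀ s → Bounded (s ×ᵥ d) (p ^ s)
Bounded-^ p≤d ℕ.zero  = Bounded-one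
Bounded-^ p≤d (suc s) = Bounded-⊗ p≤d (Bounded-^ p≤d s)

reflectPoly-^ : ∀ {n} {d : Vec ℕ n} (p : Poly n) → Bounded d p → ∀ s →
  reflectPoly (s ×ᵥ d) (p ^ s) ≡ reflectPoly d p ^ s
reflectPoly-^ p p≤d ℕ.zero  = reflectPoly-one
reflectPoly-^ {d = d} p p≤d (suc s) =
  trans (reflectPoly-⊗ p (p ^ s) p≤d (Bounded-^ p≤d s)) (cong (reflectPoly d p ⊗_) (reflectPoly-^ p p≤d s))

-- Being injective on the box, reflection preserves coefficients.
coeff-reflectPoly : ∀ {n} {d e : Vec ℕ n} (p : Poly n) → Bounded d p → e ≤ᵥ d →
  coeff (reflectPoly d p) (reflect d e) ≡ coeff p e
coeff-reflectPoly []            []           e≤d = refl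
coeff-reflectPoly {d = d} {e} ((c , f) ∷ p) (f≤d ∷ p≤d) e≤d
  with ≡-dec ℕ._≟_ (reflect d f) (reflect d e) | ≡-dec ℕ._≟_ f e
... | yes _     | yes _    = cong (c +ℤ_) (coeff-reflectPoly p p≤d e≤d)
... | yes same  | no  f≢e  = ⊥-elim (f≢e (reflect-injective f≤d e≤d same))
... | no  diff  | yes refl = ⊥-elim (diff refl)
... | no  _     | no  _    = coeff-reflectPoly p p≤d e≤d

-- The factors x_i - x_j of the Vandermonde determinant

kronecker : ∀ {n} → Fin n → Fin n → ℕ
kronecker zero    zero    = 1
kronecker zero    (suc _) = 0
kronecker (suc _) zero    = 0
kronecker (suc i) (suc a) = kronecker i a

kronecker-refl : ∀ {n} (i : Fin n) → kronecker i i ≡ 1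
kronecker-refl zero    = refl
kronecker-refl (suc i) = kronecker-refl i

kronecker-≢ : ∀ {n} {i a : Fin n} → i ≢ a → kronecker i a ≡ 0
kronecker-≢ {i = zero}  {zero}  i≢a = ⊥-elim (i≢a refl)
kronecker-≢ {i = zero}  {suc a} i≢a = refl
kronecker-≢ {i = suc i} {zero}  i≢a = refl
kronecker-≢ {i = suc i} {suc a} i≢a = kronecker-≢ (λ i≡a → i≢a (cong suc i≡a))

kronecker-opposite : ∀ {n} (j a : Fin n) → kronecker j (opposite a) ≡ kronecker (opposite j) a
kronecker-opposite j a with j Fin.≟ opposite a
... | yes refl = trans (kronecker-refl (opposite a))
                   (sym (subst (λ b → kronecker b a ≡ 1) (sym (FinP.opposite-involutive a)) (kronecker-refl a)))
... | no  j≢a′ = trans (kronecker-≢ j≢a′)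
                   (sym (kronecker-≢ (λ j′≡a → j≢a′ (trans (sym (FinP.opposite-involutive j)) (cong opposite j′≡a)))))

unit : ∀ {n} → Fin n → Vec ℕ n
unit i = tabulate (kronecker i)

lookup-unit : ∀ {n} (i a : Fin n) → lookup (unit i) a ≡ kronecker i a
lookup-unit i = lookup∘tabulate (kronecker i)

-- The exponent function used in the definition of `var`, made nameable.
varExponent : ∀ {n} (i : Fin n) → Σ (Fin n → ℕ) (λ f → var i ≡ (1ℤ , tabulate f) ∷ [])
varExponent i = _ , refl

varExponent-kronecker : ∀ {n} (i a : Fin n) → proj₁ (varExponent i) a ≡ kronecker i a
varExponent-kronecker i a with i Fin.≟ a
... | yes refl = sym (kronecker-refl i)
... | no  i≢a  = sym (kronecker-≢ i≢a)

var-unit : ∀ {n} (i : Fin n) → var i ≡ (1ℤ , unit i) ∷ []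
var-unit i = trans (proj₂ (varExponent i))
  (cong (λ v → (1ℤ , v) ∷ []) (tabulate-cong (varExponent-kronecker i)))

factor : ∀ {n} → Fin n × Fin n → Poly n
factor (i , j) = var i ⊕ neg (var j)

factor-terms : ∀ {n} (i j : Fin n) → factor (i , j) ≡ (1ℤ , unit i) ∷ (-1ℤ , unit j) ∷ []
factor-terms i j = cong₂ (λ xᵢ xⱼ → xᵢ ⊕ neg xⱼ) (var-unit i) (var-unit j)

pairBox : ∀ {n} → Fin n × Fin n → Vec ℕ n
pairBox (i , j) = unit i +ᵥ unit j

flipPair : ∀ {n} → Fin n × Fin n → Fin n × Fin n
flipPair (i , j) = (opposite j , opposite i)

reflect-unit : ∀ {n} (i j : Fin n) → reflect (unit i +ᵥ unit j) (unit i) ≡ unit (opposite j)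
reflect-unit i j = vecExt λ a → let a′ = opposite a in begin
  lookup (reflect (unit i +ᵥ unit j) (unit i)) a              ≡⟨ lookup-reflect (unit i +ᵥ unit j) (unit i) a ⟩
  lookup (unit i +ᵥ unit j) a′ ∸ lookup (unit i) a′            ≡⟨ cong (_∸ lookup (unit i) a′) (lookup-+ᵥ (unit i) (unit j) a′) ⟩
  lookup (unit i) a′ + lookup (unit j) a′ ∸ lookup (unit i) a′ ≡⟨ ℕP.m+n∸m≡n (lookup (unit i) a′) _ ⟩
  lookup (unit j) a′                                           ≡⟨ lookup-unit j a′ ⟩
  kronecker j a′                                               ≡⟨ kronecker-opposite j a ⟩
  kronecker (opposite j) a                                     ≡⟨ lookup-unit (opposite j) a ⟨
  lookup (unit (opposite j)) a                                 ∎
  where open ≡-Reasoning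

reflect-factor : ∀ {n} (y : Fin n × Fin n) → reflectPoly (pairBox y) (factor y) ≡ factor (flipPair y)
reflect-factor (i , j) = begin
  reflectPoly (unit i +ᵥ unit j) (factor (i , j))
    ≡⟨ cong (reflectPoly (unit i +ᵥ unit j)) (factor-terms i j) ⟩
  (1ℤ , reflect (unit i +ᵥ unit j) (unit i)) ∷ (-1ℤ , reflect (unit i +ᵥ unit j) (unit j)) ∷ []
    ≡⟨ cong₂ (λ u v → (1ℤ , u) ∷ (-1ℤ , v) ∷ []) (reflect-unit i j)
         (subst (λ d → reflect d (unit j) ≡ unit (opposite i)) (+ᵥ-comm (unit j) (unit i)) (reflect-unit j i)) ⟩
  (1ℤ , unit (opposite j)) ∷ (-1ℤ , unit (opposite i)) ∷ []
    ≡⟨ factor-terms (opposite j) (opposite i) ⟨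
  factor (opposite j , opposite i)
    ∎
  where open ≡-Reasoning

Bounded-factor : ∀ {n} (y : Fin n × Fin n) → Bounded (pairBox y) (factor y)
Bounded-factor (i , j) = subst (Bounded (unit i +ᵥ unit j)) (sym (factor-terms i j))
  (≤ᵥ-+ᵥ (unit i) (unit j) ∷ subst (unit j ≤ᵥ_) (+ᵥ-comm (unit j) (unit i)) (≤ᵥ-+ᵥ (unit j) (unit i)) ∷ [])

degreeVector : ∀ {n} → List (Fin n × Fin n) → Vec ℕ n
degreeVector []       = 0ᵥ
degreeVector (y ∷ ys) = pairBox y +ᵥ degreeVector ys

Bounded-factors : ∀ {n} (ys : List (Fin n × Fin n)) → Bounded (degreeVector ys) (prodList (map factor ys))
Bounded-factors []       = Bounded-one
Bounded-factors (y ∷ ys) = Bounded-⊗ (Bounded-factor y) (Bounded-factors ys)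

reflect-factors : ∀ {n} (ys : List (Fin n × Fin n)) →
  reflectPoly (degreeVector ys) (prodList (map factor ys)) ≡ prodList (map factor (map flipPair ys))
reflect-factors []       = reflectPoly-one
reflect-factors (y ∷ ys) =
  trans (reflectPoly-⊗ (factor y) _ (Bounded-factor y) (Bounded-factors ys))
        (cong₂ _⊗_ (reflect-factor y) (reflect-factors ys))

Increasing : ∀ {n} → Fin n × Fin n → Set
Increasing (i , j) = i Fin.< j

increasing? : ∀ {n} (x : Fin n × Fin n) → Dec (Increasing x)
increasing? (i , j) = i FinP.<? j

-- The list `pairs n` is built from an anonymous helper listing (i , j)
-- when i < j; `pairs-unfold` exposes that helper.
pairs-unfold : ∀ n → Σ (Fin n → Fin n → List (Fin n × Fin n))
  (λ L → pairs n ≡ concatMap (λ i → concatMap (L i) (allFin n)) (allFin n))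
pairs-unfold n = _ , refl

pairs-unfold-filter : ∀ {n} (i j : Fin n) → proj₁ (pairs-unfold n) i j ≡ filter increasing? ((i , j) ∷ [])
pairs-unfold-filter i j with i FinP.<? j
... | yes i<j = sym (ListP.filter-accept increasing? i<j)
... | no  i≮j = sym (ListP.filter-reject increasing? i≮j)

pairs-rows : ∀ n → pairs n ≡
  concatMap (λ i → concatMap (λ j → filter increasing? ((i , j) ∷ [])) (allFin n)) (allFin n)
pairs-rows n = trans (proj₂ (pairs-unfold n))
  (ListP.concatMap-cong (λ i → ListP.concatMap-cong (pairs-unfold-filter i) (allFin n)) (allFin n))

filter-cartesianProduct : ∀ {A B : Set} {P : A × B → Set} (P? : ∀ x → Dec (P x)) xs ys →
  concatMap (λ i → concatMap (λ j → filter P? ((i , j) ∷ [])) ys) xs ≡ filter P? (cartesianProduct xs ys)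
filter-cartesianProduct P? []       ys = refl
filter-cartesianProduct P? (x ∷ xs) ys =
  trans (cong₂ _++_ (row ys) (filter-cartesianProduct P? xs ys)) (sym (ListP.filter-++ P? (map (x ,_) ys) _))
  where
  row : ∀ ys → concatMap (λ j → filter P? ((x , j) ∷ [])) ys ≡ filter P? (map (x ,_) ys)
  row []       = refl
  row (y ∷ ys) with P? (x , y)
  ... | yes _ = cong ((x , y) ∷_) (row ys)
  ... | no  _ = row ys

pairs-filter : ∀ n → pairs n ≡ filter increasing? (cartesianProduct (allFin n) (allFin n))
pairs-filter n = trans (pairs-rows n) (filter-cartesianProduct increasing? (allFin n) (allFin n))

pairs-unique : ∀ n → Unique (pairs n)
pairs-unique n = subst Unique (sym (pairs-filter n))
  (UniqueP.filter⁺ increasing? (UniqueP.cartesianProduct⁺ (UniqueP.allFin⁺ n) (UniqueP.allFin⁺ n)))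

∈-pairs⁺ : ∀ {n} {x : Fin n × Fin n} → Increasing x → x ∈ pairs n
∈-pairs⁺ {n} {i , j} i<j = subst (_ ∈_) (sym (pairs-filter n))
  (∈-filter⁺ increasing? (∈-cartesianProduct⁺ (∈-allFin i) (∈-allFin j)) i<j)

∈-pairs⁻ : ∀ {n} {x : Fin n × Fin n} → x ∈ pairs n → Increasing x
∈-pairs⁻ {n} x∈pairs = proj₂ (∈-filter⁻ increasing? {xs = cartesianProduct (allFin n) (allFin n)}
  (subst (_ ∈_) (pairs-filter n) x∈pairs))

opposite-< : ∀ {n} {i j : Fin n} → i Fin.< j → opposite j Fin.< opposite i
opposite-< {n} {i} {j} i<j = subst₂ ℕ._<_ (sym (FinP.opposite-prop j)) (sym (FinP.opposite-prop i))
  (ℕP.∸-monoʳ-< {n} {suc (toℕ j)} {suc (toℕ i)} (ℕ.s≤s i<j) (FinP.toℕ<n j))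

flipPair-involutive : ∀ {n} (x : Fin n × Fin n) → flipPair (flipPair x) ≡ x
flipPair-involutive (i , j) = cong₂ _,_ (FinP.opposite-involutive i) (FinP.opposite-involutive j)

flipPair-injective : ∀ {n} {x y : Fin n × Fin n} → flipPair x ≡ flipPair y → x ≡ y
flipPair-injective {x = x} {y} eq =
  trans (sym (flipPair-involutive x)) (trans (cong flipPair eq) (flipPair-involutive y))

-- Flipping permutes the increasing pairs: both lists are duplicate-free and
-- have the same members.
flipPair-↭ : ∀ n → map flipPair (pairs n) ↭ pairs n
flipPair-↭ n = ∼bag⇒↭ (unique∧set⇒bag
  (UniqueP.map⁺ flipPair-injective (pairs-unique n)) (pairs-unique n) (mk⇔ to from))
  where
  to : ∀ {x} → x ∈ map flipPair (pairs n) → x ∈ pairs n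
  to x∈ with ∈-map⁻ flipPair x∈
  ... | y , y∈pairs , refl = ∈-pairs⁺ (opposite-< (∈-pairs⁻ y∈pairs))
  from : ∀ {x} → x ∈ pairs n → x ∈ map flipPair (pairs n)
  from {x} x∈pairs = subst (_∈ map flipPair (pairs n)) (flipPair-involutive x)
    (∈-map⁺ flipPair (∈-pairs⁺ (opposite-< (∈-pairs⁻ x∈pairs))))

-- Every variable occurs in exactly n - 1 factors

weightOver : {A : Set} → List A → (A → ℕ) → ℕ
weightOver []       w = 0
weightOver (x ∷ xs) w = w x + weightOver xs w

weightOver-++ : ∀ {A : Set} (xs ys : List A) w →
  weightOver (xs ++ ys) w ≡ weightOver xs w + weightOver ys w
weightOver-++ []       ys w = refl
weightOver-++ (x ∷ xs) ys w =
  trans (cong (w x +_) (weightOver-++ xs ys w)) (sym (ℕP.+-assoc (w x) _ _))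

weightOver-concatMap : ∀ {A B : Set} (f : A → List B) (xs : List A) w →
  weightOver (concatMap f xs) w ≡ weightOver xs (λ x → weightOver (f x) w)
weightOver-concatMap f []       w = refl
weightOver-concatMap f (x ∷ xs) w =
  trans (weightOver-++ (f x) (concatMap f xs) w) (cong (weightOver (f x) w +_) (weightOver-concatMap f xs w))

weightOver-tabulate : ∀ {A : Set} n (g : Fin n → A) w →
  weightOver (List.tabulate g) w ≡ ∑[ i < n ] w (g i)
weightOver-tabulate ℕ.zero  g w = refl
weightOver-tabulate (suc n) g w = cong (w (g zero) +_) (weightOver-tabulate n (λ i → g (suc i)) w)

less : ∀ {n} → Fin n → Fin n → ℕ
less _       zero    = 0
less zero    (suc _) = 1
less (suc i) (suc j) = less i j

less-< : ∀ {n} {i j : Fin n} → i Fin.< j → less i j ≡ 1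
less-< {i = zero}  {suc j} _         = refl
less-< {i = suc i} {suc j} (ℕ.s≤s i<j) = less-< i<j

less-≮ : ∀ {n} {i j : Fin n} → ¬ i Fin.< j → less i j ≡ 0
less-≮ {i = i}     {zero}  _   = refl
less-≮ {i = zero}  {suc j} i≮j = ⊥-elim (i≮j (ℕ.s≤s z≤n))
less-≮ {i = suc i} {suc j} i≮j = less-≮ (λ i<j → i≮j (ℕ.s≤s i<j))

weightOver-increasing : ∀ {n} (i j : Fin n) w →
  weightOver (filter increasing? ((i , j) ∷ [])) w ≡ less i j * w (i , j)
weightOver-increasing i j w with i FinP.<? j
... | yes i<j = begin
  weightOver (filter increasing? ((i , j) ∷ [])) w ≡⟨ cong (λ l → weightOver l w) (ListP.filter-accept increasing? i<j) ⟩
  w (i , j) + 0                                    ≡⟨ ℕP.+-identityʳ _ ⟩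
  w (i , j)                                        ≡⟨ ℕP.*-identityˡ _ ⟨
  1 * w (i , j)                                    ≡⟨ cong (_* w (i , j)) (less-< i<j) ⟨
  less i j * w (i , j)                             ∎
  where open ≡-Reasoning
... | no i≮j = trans (cong (λ l → weightOver l w) (ListP.filter-reject increasing? i≮j))
                     (cong (_* w (i , j)) (sym (less-≮ i≮j)))

weightOver-pairs : ∀ n w → weightOver (pairs n) w ≡ ∑[ i < n ] ∑[ j < n ] (less i j * w (i , j))
weightOver-pairs n w = begin
  weightOver (pairs n) w
    ≡⟨ cong (λ l → weightOver l w) (pairs-rows n) ⟩
  weightOver (concatMap row (allFin n)) w
    ≡⟨ weightOver-concatMap row (allFin n) w ⟩
  weightOver (allFin n) (λ i → weightOver (row i) w)
    ≡⟨ weightOver-tabulate n (λ i → i) _ ⟩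
  ∑[ i < n ] weightOver (row i) w
    ≡⟨ ∑.sum-cong-≗ (λ i → trans (weightOver-concatMap (λ j → filter increasing? ((i , j) ∷ [])) (allFin n) w) (weightOver-tabulate n (λ j → j) _)) ⟩
  ∑[ i < n ] ∑[ j < n ] weightOver (filter increasing? ((i , j) ∷ [])) w
    ≡⟨ ∑.sum-cong-≗ (λ i → ∑.sum-cong-≗ (λ j → weightOver-increasing i j w)) ⟩
  ∑[ i < n ] ∑[ j < n ] (less i j * w (i , j))
    ∎
  where
  open ≡-Reasoning
  row : Fin n → List (Fin n × Fin n)
  row i = concatMap (λ j → filter increasing? ((i , j) ∷ [])) (allFin n)

∑-kronecker : ∀ n (a : Fin n) (h : Fin n → ℕ) → ∑[ i < n ] (kronecker i a * h i) ≡ h a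
∑-kronecker (suc n) zero    h = begin
  1 * h zero + ∑[ i < n ] 0   ≡⟨ cong (1 * h zero +_) (∑.sum-replicate-zero n) ⟩
  1 * h zero + 0              ≡⟨ ℕP.+-identityʳ _ ⟩
  1 * h zero                  ≡⟨ ℕP.*-identityˡ _ ⟩
  h zero                      ∎
  where open ≡-Reasoning
∑-kronecker (suc n) (suc a) h = ∑-kronecker n a (λ i → h (suc i))

∑-ones : ∀ n → ∑[ i < n ] 1 ≡ n
∑-ones ℕ.zero  = refl
∑-ones (suc n) = cong suc (∑-ones n)

-- Every index a is comparable with the n - 1 other indices.
∑-comparable : ∀ n (a : Fin n) → ∑[ j < n ] (less a j + less j a) ≡ n ∸ 1
∑-comparable (suc n)       zero    = ∑-ones n
∑-comparable (suc (suc n)) (suc a) = cong suc (∑-comparable (suc n) a)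

incidence : ∀ {n} → Fin n → Fin n × Fin n → ℕ
incidence a (i , j) = kronecker i a + kronecker j a

lookup-degreeVector : ∀ {n} (ys : List (Fin n × Fin n)) a →
  lookup (degreeVector ys) a ≡ weightOver ys (incidence a)
lookup-degreeVector []             a = lookup-replicate a 0
lookup-degreeVector ((i , j) ∷ ys) a = begin
  lookup (unit i +ᵥ unit j +ᵥ degreeVector ys) a
    ≡⟨ lookup-+ᵥ (unit i +ᵥ unit j) (degreeVector ys) a ⟩
  lookup (unit i +ᵥ unit j) a + lookup (degreeVector ys) a
    ≡⟨ cong₂ _+_ (trans (lookup-+ᵥ (unit i) (unit j) a) (cong₂ _+_ (lookup-unit i a) (lookup-unit j a)))
                 (lookup-degreeVector ys a) ⟩
  incidence a (i , j) + weightOver ys (incidence a)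
    ∎
  where open ≡-Reasoning

degreeVector-pairs : ∀ n (a : Fin n) → lookup (degreeVector (pairs n)) a ≡ n ∸ 1
degreeVector-pairs n a = begin
  lookup (degreeVector (pairs n)) a
    ≡⟨ lookup-degreeVector (pairs n) a ⟩
  weightOver (pairs n) (incidence a)
    ≡⟨ weightOver-pairs n (incidence a) ⟩
  ∑[ i < n ] ∑[ j < n ] (less i j * (kronecker i a + kronecker j a))
    ≡⟨ ∑.sum-cong-≗ (λ i → trans (∑.sum-cong-≗ (λ j → ℕP.*-distribˡ-+ (less i j) (kronecker i a) (kronecker j a)))
                                  (∑.∑-distrib-+ (λ j → less i j * kronecker i a) (λ j → less i j * kronecker j a))) ⟩
  ∑[ i < n ] (∑[ j < n ] (less i j * kronecker i a) + ∑[ j < n ] (less i j * kronecker j a))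
    ≡⟨ ∑.∑-distrib-+ (λ i → ∑[ j < n ] (less i j * kronecker i a)) (λ i → ∑[ j < n ] (less i j * kronecker j a)) ⟩
  ∑[ i < n ] ∑[ j < n ] (less i j * kronecker i a) + ∑[ i < n ] ∑[ j < n ] (less i j * kronecker j a)
    ≡⟨ cong₂ _+_ asFirst asSecond ⟩
  ∑[ j < n ] less a j + ∑[ i < n ] less i a
    ≡⟨ ∑.∑-distrib-+ (less a) (λ j → less j a) ⟨
  ∑[ j < n ] (less a j + less j a)
    ≡⟨ ∑-comparable n a ⟩
  n ∸ 1
    ∎
  where
  open ≡-Reasoning
  asFirst : ∑[ i < n ] ∑[ j < n ] (less i j * kronecker i a) ≡ ∑[ j < n ] less a j
  asFirst = begin
    ∑[ i < n ] ∑[ j < n ] (less i j * kronecker i a)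
      ≡⟨ ∑.sum-cong-≗ (λ i → trans (∑.sum-cong-≗ (λ j → ℕP.*-comm (less i j) (kronecker i a))) (sym (∑.*-distribˡ-sum (kronecker i a) (less i)))) ⟩
    ∑[ i < n ] (kronecker i a * ∑[ j < n ] less i j)
      ≡⟨ ∑-kronecker n a (λ i → ∑[ j < n ] less i j) ⟩
    ∑[ j < n ] less a j
      ∎
  asSecond : ∑[ i < n ] ∑[ j < n ] (less i j * kronecker j a) ≡ ∑[ i < n ] less i a
  asSecond = begin
    ∑[ i < n ] ∑[ j < n ] (less i j * kronecker j a)
      ≡⟨ ∑.∑-comm (λ i j → less i j * kronecker j a) ⟩
    ∑[ j < n ] ∑[ i < n ] (less i j * kronecker j a)
      ≡⟨ ∑.sum-cong-≗ (λ j → trans (∑.sum-cong-≗ (λ i → ℕP.*-comm (less i j) (kronecker j a))) (sym (∑.*-distribˡ-sum (kronecker j a) (λ i → less i j)))) ⟩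
    ∑[ j < n ] (kronecker j a * ∑[ i < n ] less i j)
      ≡⟨ ∑-kronecker n a (λ j → ∑[ i < n ] less i j) ⟩
    ∑[ i < n ] less i a
      ∎

-- Symmetry of the coefficients of powers of the Vandermonde determinant

-- Reflecting the Vandermonde determinant in its box only permutes its factors.
vandermonde-reflect : ∀ n → reflectPoly (degreeVector (pairs n)) (vandermonde n) ≈ vandermonde n
vandermonde-reflect n e =
  trans (cong (λ p → coeff p e) (reflect-factors (pairs n)))
        (prodList-↭ (PermP.map⁺ factor (flipPair-↭ n)) e)

reflect-constant : ∀ {n} {d : Vec ℕ n} {c} → (∀ a → lookup d a ≡ c) → ∀ e → reflect d e ≡ boxComplement c e
reflect-constant d≡c e = tabulate-cong (λ a → cong (_∸ lookup e (opposite a)) (d≡c (opposite a)))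

vandermonde-^-symmetry : ∀ n s (e : Vec ℕ n) → (∀ a → lookup e a ≤ s * (n ∸ 1)) →
  coeff (vandermonde n ^ s) e ≡ coeff (vandermonde n ^ s) (boxComplement (s * (n ∸ 1)) e)
vandermonde-^-symmetry n s e e-fits = begin
  coeff (V ^ s) e                             ≡⟨ coeff-reflectPoly (V ^ s) (Bounded-^ V-bounded s) e≤box ⟨
  coeff (reflectPoly box (V ^ s)) (reflect box e) ≡⟨ cong (λ p → coeff p (reflect box e)) (reflectPoly-^ V V-bounded s) ⟩
  coeff (reflectPoly D V ^ s) (reflect box e) ≡⟨ ^-cong s (vandermonde-reflect n) (reflect box e) ⟩
  coeff (V ^ s) (reflect box e)               ≡⟨ cong (coeff (V ^ s)) (reflect-constant {d = box} box-entries e) ⟩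
  coeff (V ^ s) (boxComplement (s * (n ∸ 1)) e) ∎
  where
  open ≡-Reasoning
  V = vandermonde n
  D = degreeVector (pairs n)
  box = s ×ᵥ D
  V-bounded : Bounded D V
  V-bounded = Bounded-factors (pairs n)
  box-entries : ∀ a → lookup box a ≡ s * (n ∸ 1)
  box-entries a = trans (lookup-×ᵥ s D a) (cong (s *_) (degreeVector-pairs n a))
  e≤box : e ≤ᵥ box
  e≤box = ext λ a → subst (lookup e a ≤_) (sym (box-entries a)) (e-fits a)

lookup-boxComplement : ∀ {n} c (e : Vec ℕ n) a → lookup (boxComplement c e) a ≡ c ∸ lookup e (opposite a)
lookup-boxComplement c e a = lookup∘tabulate (λ a → c ∸ lookup e (opposite a)) a

lookup-delta : ∀ m (a : Fin (suc m)) → lookup (delta (suc m)) a ≡ m ∸ toℕ a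
lookup-delta m a = lookup∘tabulate (λ a → suc m ∸ suc (toℕ a)) a

staircase-fits : ∀ m b (lam : Vec ℕ (suc m)) → (∀ a → lookup lam a ≤ b) →
  ∀ a → lookup (lam +ᵥ delta (suc m)) a ≤ m + b
staircase-fits m b lam lam≤b a = begin
  lookup (lam +ᵥ delta (suc m)) a         ≡⟨ lookup-+ᵥ lam (delta (suc m)) a ⟩
  lookup lam a + lookup (delta (suc m)) a ≡⟨ cong (lookup lam a +_) (lookup-delta m a) ⟩
  lookup lam a + (m ∸ toℕ a)              ≤⟨ ℕP.+-mono-≤ (lam≤b a) (ℕP.m∸n≤m m (toℕ a)) ⟩
  b + m                                   ≡⟨ ℕP.+-comm b m ⟩
  m + b                                   ∎
  where open ℕP.≤-Reasoning

boxComplement-staircase : ∀ m b (lam : Vec ℕ (suc m)) → (∀ a → lookup lam a ≤ b) →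
  boxComplement (m + b) (lam +ᵥ delta (suc m)) ≡ boxComplement b lam +ᵥ delta (suc m)
boxComplement-staircase m b lam lam≤b = vecExt λ a → let a′ = opposite a in begin
  lookup (boxComplement (m + b) (lam +ᵥ delta (suc m))) a
    ≡⟨ lookup-boxComplement (m + b) (lam +ᵥ delta (suc m)) a ⟩
  (m + b) ∸ lookup (lam +ᵥ delta (suc m)) a′
    ≡⟨ cong₂ _∸_ (ℕP.+-comm m b) (trans (lookup-+ᵥ lam (delta (suc m)) a′) (cong (lookup lam a′ +_) (trans (lookup-delta m a′) (m∸a′≡a a)))) ⟩
  (b + m) ∸ (lookup lam a′ + toℕ a)
    ≡⟨ +-∸-interchange (lam≤b a′) (FinP.toℕ≤pred[n] a) ⟩
  (b ∸ lookup lam a′) + (m ∸ toℕ a)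
    ≡⟨ cong₂ _+_ (lookup-boxComplement b lam a) (lookup-delta m a) ⟨
  lookup (boxComplement b lam) a + lookup (delta (suc m)) a
    ≡⟨ lookup-+ᵥ (boxComplement b lam) (delta (suc m)) a ⟨
  lookup (boxComplement b lam +ᵥ delta (suc m)) a
    ∎
  where
  open ≡-Reasoning
  m∸a′≡a : ∀ a → m ∸ toℕ (opposite a) ≡ toℕ a
  m∸a′≡a a = trans (cong (m ∸_) (FinP.opposite-prop a)) (ℕP.m∸[m∸n]≡n (FinP.toℕ≤pred[n] a))

mainTheorem1 : (k m : ℕ) → 1 ≤ k → (lam : Vec ℕ (suc m)) →
    Decreasing lam → sum lam ≡ k * suc m * m →
    lookup lam zero ≤ 2 * k * m →
    vdmSchurCoeff (suc m) k lam ≡ vdmSchurCoeff (suc m) k (boxComplement (2 * k * m) lam)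
mainTheorem1 k m _ lam decreasing _ lam₀≤b = begin
  coeff (V ^ s) (lam +ᵥ δ)
    ≡⟨ vandermonde-^-symmetry (suc m) s (lam +ᵥ δ) (staircase-fits m b lam lam≤b) ⟩
  coeff (V ^ s) (boxComplement (m + b) (lam +ᵥ δ))
    ≡⟨ cong (coeff (V ^ s)) (boxComplement-staircase m b lam lam≤b) ⟩
  coeff (V ^ s) (boxComplement b lam +ᵥ δ)
    ∎
  where
  open ≡-Reasoning
  s = suc (2 * k)
  b = 2 * k * m
  V = vandermonde (suc m)
  δ = delta (suc m)
  lam≤b : ∀ a → lookup lam a ≤ b
  lam≤b a = ℕP.≤-trans (decreasing zero a z≤n) lam₀≤b
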